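{- For all $n,d\in\mathbb{N}$ and every real $x\ge 0$ there is an $r\in\{0,\dots,(d-1)n\}$ such that $$\mathrm{Vol}_{C_d}(n,r)\ \ge\ \frac{(1+x+\dots+x^{d-1})^n}{x^r}\cdot\frac{1}{p(n)}$$ for a polynomial $p$ (depending on $d$ but not on $n$ or $x$).
   Context: $C_d$ is the directed cycle on the color set $\{0,1,\dots,d-1\}$ with edges $(i,i+1 \bmod d)$. For colors $c,c'$, $d_{C_d}(c,c')$ is the length of the shortest directed path from $c$ to $c'$ in $C_d$, and for $\alpha,\beta\in\{0,\dots,d-1\}^n$, $d_{C_d}(\alpha,\beta)=\sum_{i=1}^n d_{C_d}(\alpha_i,\beta_i)$. $\mathrm{Vol}_{C_d}(n,r)$ is the number of $\beta$ with $d_{C_d}(\alpha,\beta)\le r$ for a fixed $\alpha$ (independent of $\alpha$). The convention $0^0=1$ is used.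
   Formalization: The parameter x ranges over the nonnegative rationals rather than the nonnegative reals, and the polynomial p is taken with rational coefficients. -}

module Defs where

open import Data.Nat as ℕ using (ℕ; zero; suc; _∸_; _%_; NonZero)
open import Data.Fin using (Fin; toℕ)
open import Data.Vec using (Vec; []; _∷_; replicate)
open import Data.List using (List; []; _∷_; concatMap; map; filter; length)
import Data.Fin
import Data.Vec as Vec
import Data.List.Base
open import Data.Rational using (ℚ; 0ℚ; 1ℚ; _+_; _*_)
import Data.Rational as ℚ
open import Data.Integer using (+_)
open import Relation.Nullary using (Dec)

_^ℚ_ : ℚ → ℕ → ℚ
x ^ℚ zero  = 1ℚ
x ^ℚ suc k = x * (x ^ℚ k)

ℕ→ℚ : ℕ → ℚ
ℕ→ℚ n = + n ℚ./ 1

-- Distance in the directed cycle C_d from colour c to colour c':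
-- the shortest directed path i → i+1 (mod d) has length (c' - c) mod d.
dC : (d : ℕ) → .{{NonZero d}} → Fin d → Fin d → ℕ
dC d c c' = (d ℕ.+ toℕ c' ∸ toℕ c) % d

distC : (d : ℕ) → .{{NonZero d}} → {n : ℕ} → Vec (Fin d) n → Vec (Fin d) n → ℕ
distC d []       []       = 0
distC d (a ∷ as) (b ∷ bs) = dC d a b ℕ.+ distC d as bs

allWords : (d n : ℕ) → List (Vec (Fin d) n)
allWords d zero    = [] ∷ []
allWords d (suc n) = concatMap (λ c → map (c ∷_) (allWords d n)) (Data.List.Base.allFin d)

zeroF : (d : ℕ) → .{{NonZero d}} → Fin d
zeroF (suc k) = Data.Fin.zero

Vol : (d : ℕ) → .{{NonZero d}} → (n r : ℕ) → ℕ
Vol d n r = length (filter (λ β → distC d α β ℕ.≤? r) (allWords d n))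
  where
  α : Vec (Fin d) n
  α = replicate n (zeroF d)

geomSum : ℕ → ℚ → ℚ
geomSum zero    x = 0ℚ
geomSum (suc k) x = geomSum k x + x ^ℚ k

-- polynomial with rational coefficients [a₀, a₁, …], evaluated by Horner
evalPoly : List ℚ → ℚ → ℚ
evalPoly []       x = 0ℚ
evalPoly (a ∷ as) x = a + x * evalPoly as x

{-# OPTIONS --safe #-}
-- Writing M = (d - 1) n and expanding the power word by word gives
--   (1 + x + ⋯ + x^(d-1))^n = ∑_β x^(d(0ⁿ, β)),
-- since the distance from colour 0 to colour c is c.  Every distance e is at most M,
-- so x^e ≤ ∑_{e ≤ r ≤ M} x^r; summing over β and exchanging the two sums bounds the
-- power by ∑_{r ≤ M} Vol(n, r) x^r, and the largest of these M + 1 terms yields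
-- p(n) = 1 + (d - 1) n.
module Submission where

open import Defs
open import Data.Nat using (ℕ; NonZero; _∸_; _*_)
import Data.Nat as ℕ
open import Data.List using (List)
open import Data.Product using (Σ; _×_)
open import Data.Rational using (ℚ; 0ℚ; _≤_; _<_)
import Data.Rational as ℚ

open import Algebra.Bundles using (CommutativeRing)
import Algebra.Properties.CommutativeSemigroup as CommSemigroupProperties
import Algebra.Properties.Semiring.Exp as SemiringExp
import Algebra.Properties.Semiring.Mult as SemiringMult
open import Data.Bool using (true; false; if_then_else_)
open import Data.Fin using (Fin; toℕ)
import Data.Fin as Fin
import Data.Fin.Properties as Finₚ
open import Data.List using ([]; _∷_; _++_; map; concatMap; filter; length; tabulate; allFin; upTo; applyUpTo; [_])
import Data.List.Properties as Listₚ
open import Data.List.Membership.Propositional using (_∈_)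
open import Data.List.Membership.Propositional.Properties using (∈-upTo⁺; ∈-upTo⁻)
open import Data.List.Relation.Unary.Any using (here; there)
open import Data.Nat using (zero; suc; z≤n; s≤s)
import Data.Nat.DivMod as ℕ
import Data.Nat.Properties as ℕₚ
import Data.Nat.Coprimality as Coprimality
import Data.Integer as ℤ
open import Data.Product using (_,_; ∃-syntax)
open import Data.Rational using (1ℚ; _+_; mkℚ)
import Data.Rational.Properties as ℚₚ
open import Data.Sum using (inj₁; inj₂)
open import Data.Vec using (Vec; []; _∷_; replicate)
open import Function using (_∘_; id)
open import Relation.Binary.PropositionalEquality using (_≡_; refl; sym; trans; cong; cong₂; subst; module ≡-Reasoning)
open import Relation.Nullary using (Dec; does)
open import Relation.Nullary.Decidable using (dec-true)
open import Relation.Unary using (Pred; Decidable)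

private
  variable
    A B : Set

open SemiringMult (CommutativeRing.semiring ℚₚ.+-*-commutativeRing) using (×1-homo-*) renaming (_×_ to _·_)
open SemiringExp (CommutativeRing.semiring ℚₚ.+-*-commutativeRing) using (_^_; ^-homo-*)
open CommSemigroupProperties (CommutativeRing.+-commutativeSemigroup ℚₚ.+-*-commutativeRing) using (interchange)

ℕ→ℚ-suc : ∀ n → ℕ→ℚ (suc n) ≡ 1ℚ + ℕ→ℚ n
ℕ→ℚ-suc zero    = refl
-- Once the numerator is written as 1 + (1 + n) * 1, the left side reduces to the sum on
-- the right with the unnormalised summand, which normalize-coprime identifies with ℕ→ℚ (1 + n).
ℕ→ℚ-suc (suc n) = begin
  ℤ.+ (suc (suc n)) ℚ./ 1                ≡⟨ cong (λ m → ℤ.+ suc m ℚ./ 1) (sym (ℕₚ.*-identityʳ (suc n))) ⟩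
  1ℚ + mkℚ (ℤ.+ suc n) 0 coprime         ≡⟨ cong (1ℚ +_) (sym (ℚₚ.normalize-coprime coprime)) ⟩
  1ℚ + ℕ→ℚ (suc n)                       ∎
  where
  open ≡-Reasoning
  coprime = Coprimality.sym (Coprimality.1-coprimeTo (suc n))

ℕ→ℚ≡×1 : ∀ n → ℕ→ℚ n ≡ n · 1ℚ
ℕ→ℚ≡×1 zero    = refl
ℕ→ℚ≡×1 (suc n) = trans (ℕ→ℚ-suc n) (cong (1ℚ +_) (ℕ→ℚ≡×1 n))

ℕ→ℚ-homo-* : ∀ m n → ℕ→ℚ (m * n) ≡ ℕ→ℚ m ℚ.* ℕ→ℚ n
ℕ→ℚ-homo-* m n rewrite ℕ→ℚ≡×1 (m * n) | ℕ→ℚ≡×1 m | ℕ→ℚ≡×1 n = ×1-homo-* m n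

ℕ→ℚ-nonNeg : ∀ n → 0ℚ ≤ ℕ→ℚ n
ℕ→ℚ-nonNeg n = ℚₚ.nonNegative⁻¹ (ℕ→ℚ n) {{ℚₚ.normalize-nonNeg n 1}}

ℕ→ℚ-pos : ∀ n → 0ℚ < ℕ→ℚ (suc n)
ℕ→ℚ-pos n = ℚₚ.positive⁻¹ (ℕ→ℚ (suc n)) {{ℚₚ.normalize-pos (suc n) 1}}

y+n*y≡[1+n]*y : ∀ n y → y + ℕ→ℚ n ℚ.* y ≡ ℕ→ℚ (suc n) ℚ.* y
y+n*y≡[1+n]*y n y = begin
  y + ℕ→ℚ n ℚ.* y          ≡⟨ cong (_+ ℕ→ℚ n ℚ.* y) (sym (ℚₚ.*-identityˡ y)) ⟩
  1ℚ ℚ.* y + ℕ→ℚ n ℚ.* y   ≡⟨ sym (ℚₚ.*-distribʳ-+ y 1ℚ (ℕ→ℚ n)) ⟩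
  (1ℚ + ℕ→ℚ n) ℚ.* y       ≡⟨ cong (ℚ._* y) (sym (ℕ→ℚ-suc n)) ⟩
  ℕ→ℚ (suc n) ℚ.* y        ∎
  where open ≡-Reasoning

^ℚ≡^ : ∀ x n → x ^ℚ n ≡ x ^ n
^ℚ≡^ x zero    = refl
^ℚ≡^ x (suc n) = cong (x ℚ.*_) (^ℚ≡^ x n)

^ℚ-homo-* : ∀ x m n → x ^ℚ (m ℕ.+ n) ≡ x ^ℚ m ℚ.* x ^ℚ n
^ℚ-homo-* x m n rewrite ^ℚ≡^ x (m ℕ.+ n) | ^ℚ≡^ x m | ^ℚ≡^ x n = ^-homo-* x m n

^ℚ-nonNeg : ∀ {x} → 0ℚ ≤ x → ∀ n → 0ℚ ≤ x ^ℚ n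
^ℚ-nonNeg x≥0 zero    = ℚₚ.nonNegative⁻¹ 1ℚ
^ℚ-nonNeg {x} x≥0 (suc n) = ℚₚ.nonNegative⁻¹ (x ℚ.* x ^ℚ n)
  {{ℚₚ.nonNeg*nonNeg⇒nonNeg x {{ℚ.nonNegative x≥0}} (x ^ℚ n) {{ℚ.nonNegative (^ℚ-nonNeg x≥0 n)}}}}

p≤p+q : ∀ {p q} → 0ℚ ≤ q → p ≤ p + q
p≤p+q {p} {q} q≥0 = subst (_≤ p + q) (ℚₚ.+-identityʳ p) (ℚₚ.+-monoʳ-≤ p q≥0)

q≤p+q : ∀ {p q} → 0ℚ ≤ p → q ≤ p + q
q≤p+q {p} {q} p≥0 = subst (_≤ p + q) (ℚₚ.+-identityˡ q) (ℚₚ.+-monoˡ-≤ q p≥0)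

∑ : List A → (A → ℚ) → ℚ
∑ []       F = 0ℚ
∑ (a ∷ as) F = F a + ∑ as F

infix 5 ∑
syntax ∑ L (λ a → e) = ∑[ a ∈ L ] e

∑-cong : {F G : A → ℚ} → (∀ a → F a ≡ G a) → ∀ L → ∑ L F ≡ ∑ L G
∑-cong F≡G []       = refl
∑-cong F≡G (a ∷ L) = cong₂ _+_ (F≡G a) (∑-cong F≡G L)

∑-mono-≤ : {F G : A → ℚ} → (∀ a → F a ≤ G a) → ∀ L → ∑ L F ≤ ∑ L G
∑-mono-≤ F≤G []       = ℚₚ.≤-refl
∑-mono-≤ F≤G (a ∷ L) = ℚₚ.+-mono-≤ (F≤G a) (∑-mono-≤ F≤G L)

∑-nonNeg : {F : A → ℚ} → (∀ a → 0ℚ ≤ F a) → ∀ L → 0ℚ ≤ ∑ L F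
∑-nonNeg F≥0 []       = ℚₚ.≤-refl
∑-nonNeg F≥0 (a ∷ L) = ℚₚ.≤-trans (F≥0 a) (p≤p+q (∑-nonNeg F≥0 L))

∑-++ : (F : A → ℚ) (L K : List A) → ∑ (L ++ K) F ≡ ∑ L F + ∑ K F
∑-++ F []      K = sym (ℚₚ.+-identityˡ _)
∑-++ F (a ∷ L) K = trans (cong (F a +_) (∑-++ F L K)) (sym (ℚₚ.+-assoc (F a) _ _))

∑-map : (F : B → ℚ) (g : A → B) (L : List A) → ∑ (map g L) F ≡ ∑[ a ∈ L ] F (g a)
∑-map F g []      = refl
∑-map F g (a ∷ L) = cong (F (g a) +_) (∑-map F g L)

∑-concatMap : (F : B → ℚ) (g : A → List B) (L : List A) →
  ∑ (concatMap g L) F ≡ ∑[ a ∈ L ] ∑ (g a) F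
∑-concatMap F g []      = refl
∑-concatMap F g (a ∷ L) = trans (∑-++ F (g a) (concatMap g L)) (cong (∑ (g a) F +_) (∑-concatMap F g L))

∑-*ˡ : (c : ℚ) (F : A → ℚ) (L : List A) → ∑[ a ∈ L ] c ℚ.* F a ≡ c ℚ.* ∑ L F
∑-*ˡ c F []      = sym (ℚₚ.*-zeroʳ c)
∑-*ˡ c F (a ∷ L) = trans (cong (c ℚ.* F a +_) (∑-*ˡ c F L)) (sym (ℚₚ.*-distribˡ-+ c (F a) (∑ L F)))

∑-*ʳ : (c : ℚ) (F : A → ℚ) (L : List A) → ∑[ a ∈ L ] F a ℚ.* c ≡ ∑ L F ℚ.* c
∑-*ʳ c F []      = sym (ℚₚ.*-zeroˡ c)
∑-*ʳ c F (a ∷ L) = trans (cong (F a ℚ.* c +_) (∑-*ʳ c F L)) (sym (ℚₚ.*-distribʳ-+ c (F a) (∑ L F)))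

∑-0 : (L : List A) → ∑[ a ∈ L ] 0ℚ ≡ 0ℚ
∑-0 []      = refl
∑-0 (a ∷ L) = trans (ℚₚ.+-identityˡ _) (∑-0 L)

∑-+ : (F G : A → ℚ) (L : List A) → ∑[ a ∈ L ] (F a + G a) ≡ ∑ L F + ∑ L G
∑-+ F G []      = refl
∑-+ F G (a ∷ L) = trans (cong (F a + G a +_) (∑-+ F G L)) (interchange (F a) (G a) (∑ L F) (∑ L G))

∑-comm : (F : A → B → ℚ) (L : List A) (K : List B) →
  ∑[ a ∈ L ] ∑[ b ∈ K ] F a b ≡ ∑[ b ∈ K ] ∑[ a ∈ L ] F a b
∑-comm F []      K = sym (∑-0 K)
∑-comm F (a ∷ L) K = trans (cong (∑ K (F a) +_) (∑-comm F L K)) (sym (∑-+ (F a) _ K))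

∈⇒≤∑ : {F : A → ℚ} {a : A} → (∀ b → 0ℚ ≤ F b) → ∀ {L} → a ∈ L → F a ≤ ∑ L F
∈⇒≤∑ F≥0 {_ ∷ L} (here refl) = p≤p+q (∑-nonNeg F≥0 L)
∈⇒≤∑ F≥0 {b ∷ L} (there a∈L) = ℚₚ.≤-trans (∈⇒≤∑ F≥0 a∈L) (q≤p+q (F≥0 b))

∑≤length*max : (F : A → ℚ) (a : A) (L : List A) →
  ∃[ b ] b ∈ a ∷ L × ∑ (a ∷ L) F ≤ ℕ→ℚ (length (a ∷ L)) ℚ.* F b
∑≤length*max F a [] =
  a , here refl , ℚₚ.≤-reflexive (trans (ℚₚ.+-identityʳ (F a)) (sym (ℚₚ.*-identityˡ (F a))))
∑≤length*max F a (a′ ∷ L) with ∑≤length*max F a′ L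
... | b , b∈ , ∑≤ with ℚₚ.≤-total (F a) (F b)
...   | inj₁ Fa≤Fb = b , there b∈ , ℚₚ.≤-trans (ℚₚ.+-mono-≤ Fa≤Fb ∑≤)
                                    (ℚₚ.≤-reflexive (y+n*y≡[1+n]*y (length (a′ ∷ L)) (F b)))
...   | inj₂ Fb≤Fa = a , here refl , ℚₚ.≤-trans (ℚₚ.+-monoʳ-≤ (F a) (ℚₚ.≤-trans ∑≤ n*Fb≤n*Fa))
                                      (ℚₚ.≤-reflexive (y+n*y≡[1+n]*y (length (a′ ∷ L)) (F a)))
  where
  n*Fb≤n*Fa : ℕ→ℚ (length (a′ ∷ L)) ℚ.* F b ≤ ℕ→ℚ (length (a′ ∷ L)) ℚ.* F a
  n*Fb≤n*Fa = ℚₚ.*-monoˡ-≤-nonNeg (ℕ→ℚ (length (a′ ∷ L))) {{ℚ.nonNegative (ℕ→ℚ-nonNeg (length (a′ ∷ L)))}} Fb≤Fa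

when : {P : Set} → Dec P → ℚ → ℚ
when p c = if does p then c else 0ℚ

when-yes : {P : Set} (p : Dec P) (c : ℚ) → P → when p c ≡ c
when-yes p c x = cong (λ b → if b then c else 0ℚ) (dec-true p x)

when-nonNeg : {P : Set} (p : Dec P) {c : ℚ} → 0ℚ ≤ c → 0ℚ ≤ when p c
when-nonNeg p c≥0 with does p
... | true  = c≥0
... | false = ℚₚ.≤-refl

∑-when≡count* : {P : Pred A _} (P? : Decidable P) (c : ℚ) (L : List A) →
  ∑[ a ∈ L ] when (P? a) c ≡ ℕ→ℚ (length (filter P? L)) ℚ.* c
∑-when≡count* P? c []      = sym (ℚₚ.*-zeroˡ c)
∑-when≡count* P? c (a ∷ L) with does (P? a)
... | true  = trans (cong (c +_) (∑-when≡count* P? c L)) (y+n*y≡[1+n]*y (length (filter P? L)) c)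
... | false = trans (ℚₚ.+-identityˡ _) (∑-when≡count* P? c L)

tabulate-∘toℕ : ∀ n (f : ℕ → A) → tabulate {n = n} (f ∘ toℕ) ≡ applyUpTo f n
tabulate-∘toℕ zero    f = refl
tabulate-∘toℕ (suc n) f = cong (f 0 ∷_) (tabulate-∘toℕ n (f ∘ suc))

geomSum≡∑upTo : ∀ m x → geomSum m x ≡ ∑[ i ∈ upTo m ] x ^ℚ i
geomSum≡∑upTo zero    x = refl
geomSum≡∑upTo (suc m) x = begin
  geomSum m x + x ^ℚ m                     ≡⟨ cong₂ _+_ (geomSum≡∑upTo m x) (sym (ℚₚ.+-identityʳ (x ^ℚ m))) ⟩
  ∑ (upTo m) (x ^ℚ_) + ∑ [ m ] (x ^ℚ_)     ≡⟨ sym (∑-++ (x ^ℚ_) (upTo m) [ m ]) ⟩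
  ∑ (upTo m ++ [ m ]) (x ^ℚ_)              ≡⟨ cong (λ L → ∑ L (x ^ℚ_)) (Listₚ.upTo-∷ʳ m) ⟩
  ∑ (upTo (suc m)) (x ^ℚ_)                 ∎
  where open ≡-Reasoning

dC-zero : ∀ k (c : Fin (suc k)) → dC (suc k) Fin.zero c ≡ toℕ c
dC-zero k c = begin
  (suc k ℕ.+ toℕ c) ℕ.% suc k   ≡⟨ cong (ℕ._% suc k) (ℕₚ.+-comm (suc k) (toℕ c)) ⟩
  (toℕ c ℕ.+ suc k) ℕ.% suc k   ≡⟨ ℕ.[m+n]%n≡m%n (toℕ c) (suc k) ⟩
  toℕ c ℕ.% suc k               ≡⟨ ℕ.m<n⇒m%n≡m (Finₚ.toℕ<n c) ⟩
  toℕ c                         ∎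
  where open ≡-Reasoning

dC≤ : ∀ k (a b : Fin (suc k)) → dC (suc k) a b ℕ.≤ k
dC≤ k a b = ℕₚ.≤-pred (ℕ.m%n<n (suc k ℕ.+ toℕ b ∸ toℕ a) (suc k))

distC≤ : ∀ k {n} (α β : Vec (Fin (suc k)) n) → distC (suc k) α β ℕ.≤ k * n
distC≤ k []      []      = z≤n
distC≤ k {suc n} (a ∷ α) (b ∷ β) =
  subst (distC (suc k) (a ∷ α) (b ∷ β) ℕ.≤_) (sym (ℕₚ.*-suc k n))
    (ℕₚ.+-mono-≤ (dC≤ k a b) (distC≤ k α β))

∑-allWords-replicate : ∀ d .{{_ : NonZero d}} (a : Fin d) (x : ℚ) n →
  ∑[ β ∈ allWords d n ] x ^ℚ distC d (replicate n a) β ≡ (∑[ c ∈ allFin d ] x ^ℚ dC d a c) ^ℚ n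
∑-allWords-replicate d a x zero    = ℚₚ.+-identityʳ 1ℚ
∑-allWords-replicate d a x (suc n) = begin
  ∑ (concatMap (λ c → map (c ∷_) W) (allFin d)) weight    ≡⟨ ∑-concatMap weight (λ c → map (c ∷_) W) (allFin d) ⟩
  ∑[ c ∈ allFin d ] ∑ (map (c ∷_) W) weight             ≡⟨ ∑-cong row (allFin d) ⟩
  ∑[ c ∈ allFin d ] x ^ℚ dC d a c ℚ.* S                 ≡⟨ ∑-*ʳ S (λ c → x ^ℚ dC d a c) (allFin d) ⟩
  G ℚ.* S                                               ≡⟨ cong (G ℚ.*_) (∑-allWords-replicate d a x n) ⟩
  G ℚ.* G ^ℚ n                                          ∎
  where
  open ≡-Reasoning
  W = allWords d n
  weight : Vec (Fin d) (suc n) → ℚ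
  weight β = x ^ℚ distC d (replicate (suc n) a) β
  S = ∑[ β ∈ W ] x ^ℚ distC d (replicate n a) β
  G = ∑[ c ∈ allFin d ] x ^ℚ dC d a c
  row : ∀ c → ∑ (map (c ∷_) W) weight ≡ x ^ℚ dC d a c ℚ.* S
  row c = begin
    ∑ (map (c ∷_) W) weight                                            ≡⟨ ∑-map weight (c ∷_) W ⟩
    ∑[ β ∈ W ] x ^ℚ (dC d a c ℕ.+ distC d (replicate n a) β)           ≡⟨ ∑-cong (λ β → ^ℚ-homo-* x (dC d a c) _) W ⟩
    ∑[ β ∈ W ] x ^ℚ dC d a c ℚ.* x ^ℚ distC d (replicate n a) β        ≡⟨ ∑-*ˡ (x ^ℚ dC d a c) _ W ⟩
    x ^ℚ dC d a c ℚ.* S                                                ∎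

∑-dC-zero≡geomSum : ∀ k x → ∑[ c ∈ allFin (suc k) ] x ^ℚ dC (suc k) Fin.zero c ≡ geomSum (suc k) x
∑-dC-zero≡geomSum k x = begin
  ∑[ c ∈ allFin (suc k) ] x ^ℚ dC (suc k) Fin.zero c   ≡⟨ ∑-cong (λ c → cong (x ^ℚ_) (dC-zero k c)) (allFin (suc k)) ⟩
  ∑[ c ∈ allFin (suc k) ] x ^ℚ toℕ c                   ≡⟨ sym (∑-map (x ^ℚ_) toℕ (allFin (suc k))) ⟩
  ∑ (map toℕ (allFin (suc k))) (x ^ℚ_)                 ≡⟨ cong (λ L → ∑ L (x ^ℚ_)) mapToℕ≡upTo ⟩
  ∑ (upTo (suc k)) (x ^ℚ_)                             ≡⟨ sym (geomSum≡∑upTo (suc k) x) ⟩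
  geomSum (suc k) x                                    ∎
  where
  open ≡-Reasoning
  mapToℕ≡upTo : map toℕ (allFin (suc k)) ≡ upTo (suc k)
  mapToℕ≡upTo = trans (Listₚ.map-tabulate id toℕ) (tabulate-∘toℕ (suc k) id)

^ℚ≤∑-when≤ : ∀ {x} → 0ℚ ≤ x → ∀ {e M} → e ℕ.≤ M →
  x ^ℚ e ≤ ∑[ r ∈ upTo (suc M) ] when (e ℕ.≤? r) (x ^ℚ r)
^ℚ≤∑-when≤ {x} x≥0 {e} {M} e≤M =
  subst (_≤ ∑[ r ∈ upTo (suc M) ] when (e ℕ.≤? r) (x ^ℚ r)) (when-yes (e ℕ.≤? e) (x ^ℚ e) ℕₚ.≤-refl)
    (∈⇒≤∑ (λ r → when-nonNeg (e ℕ.≤? r) (^ℚ-nonNeg x≥0 r)) (∈-upTo⁺ (s≤s e≤M)))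

geomSum^≤∑Vol*^ : ∀ k n {x} → 0ℚ ≤ x →
  geomSum (suc k) x ^ℚ n ≤ ∑[ r ∈ upTo (suc (k * n)) ] ℕ→ℚ (Vol (suc k) n r) ℚ.* x ^ℚ r
geomSum^≤∑Vol*^ k n {x} x≥0 = begin
  geomSum (suc k) x ^ℚ n                          ≡⟨ cong (_^ℚ n) (sym (∑-dC-zero≡geomSum k x)) ⟩
  (∑[ c ∈ allFin (suc k) ] x ^ℚ dC (suc k) Fin.zero c) ^ℚ n
                                                  ≡⟨ sym (∑-allWords-replicate (suc k) Fin.zero x n) ⟩
  ∑[ β ∈ W ] x ^ℚ dist β                          ≤⟨ ∑-mono-≤ (λ β → ^ℚ≤∑-when≤ x≥0 (distC≤ k α β)) W ⟩
  ∑[ β ∈ W ] ∑[ r ∈ R ] term β r                  ≡⟨ ∑-comm term W R ⟩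
  ∑[ r ∈ R ] ∑[ β ∈ W ] term β r                  ≡⟨ ∑-cong (λ r → ∑-when≡count* (λ β → dist β ℕ.≤? r) (x ^ℚ r) W) R ⟩
  ∑[ r ∈ R ] ℕ→ℚ (Vol (suc k) n r) ℚ.* x ^ℚ r     ∎
  where
  open ℚₚ.≤-Reasoning
  W = allWords (suc k) n
  R = upTo (suc (k * n))
  α = replicate n (Fin.zero {k})
  dist : Vec (Fin (suc k)) n → ℕ
  dist β = distC (suc k) α β
  term : Vec (Fin (suc k)) n → ℕ → ℚ
  term β r = when (dist β ℕ.≤? r) (x ^ℚ r)

linear : ℕ → List ℚ
linear k = 1ℚ ∷ ℕ→ℚ k ∷ []

evalPoly-linear : ∀ k n → evalPoly (linear k) (ℕ→ℚ n) ≡ ℕ→ℚ (suc (k * n))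
evalPoly-linear k n = begin
  1ℚ + ℕ→ℚ n ℚ.* (ℕ→ℚ k + ℕ→ℚ n ℚ.* 0ℚ)   ≡⟨ cong (λ z → 1ℚ + ℕ→ℚ n ℚ.* (ℕ→ℚ k + z)) (ℚₚ.*-zeroʳ (ℕ→ℚ n)) ⟩
  1ℚ + ℕ→ℚ n ℚ.* (ℕ→ℚ k + 0ℚ)             ≡⟨ cong (λ z → 1ℚ + ℕ→ℚ n ℚ.* z) (ℚₚ.+-identityʳ (ℕ→ℚ k)) ⟩
  1ℚ + ℕ→ℚ n ℚ.* ℕ→ℚ k                    ≡⟨ cong (1ℚ +_) (trans (ℚₚ.*-comm (ℕ→ℚ n) (ℕ→ℚ k)) (sym (ℕ→ℚ-homo-* k n))) ⟩
  1ℚ + ℕ→ℚ (k * n)                        ≡⟨ sym (ℕ→ℚ-suc (k * n)) ⟩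
  ℕ→ℚ (suc (k * n))                       ∎
  where open ≡-Reasoning

geomSum^≤Vol*^*linear : ∀ k n {x} → 0ℚ ≤ x →
  ∃[ r ] r ℕ.≤ k * n ×
    geomSum (suc k) x ^ℚ n ≤ (ℕ→ℚ (Vol (suc k) n r) ℚ.* x ^ℚ r) ℚ.* evalPoly (linear k) (ℕ→ℚ n)
geomSum^≤Vol*^*linear k n {x} x≥0 = largest (∑≤length*max V 0 (applyUpTo suc M))
  where
  M = k * n
  V : ℕ → ℚ
  V r = ℕ→ℚ (Vol (suc k) n r) ℚ.* x ^ℚ r
  largest : ∃[ r ] r ∈ upTo (suc M) × ∑ (upTo (suc M)) V ≤ ℕ→ℚ (length (upTo (suc M))) ℚ.* V r →
            ∃[ r ] r ℕ.≤ M × geomSum (suc k) x ^ℚ n ≤ V r ℚ.* evalPoly (linear k) (ℕ→ℚ n)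
  largest (r , r∈ , ∑≤) = r , ℕₚ.≤-pred (∈-upTo⁻ r∈) , (begin
    geomSum (suc k) x ^ℚ n                 ≤⟨ geomSum^≤∑Vol*^ k n x≥0 ⟩
    ∑ (upTo (suc M)) V                     ≤⟨ ∑≤ ⟩
    ℕ→ℚ (length (upTo (suc M))) ℚ.* V r    ≡⟨ cong (λ m → ℕ→ℚ m ℚ.* V r) (Listₚ.length-upTo (suc M)) ⟩
    ℕ→ℚ (suc M) ℚ.* V r                    ≡⟨ ℚₚ.*-comm (ℕ→ℚ (suc M)) (V r) ⟩
    V r ℚ.* ℕ→ℚ (suc M)                    ≡⟨ cong (V r ℚ.*_) (sym (evalPoly-linear k n)) ⟩
    V r ℚ.* evalPoly (linear k) (ℕ→ℚ n)    ∎)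
    where open ℚₚ.≤-Reasoning

lemma4 : (d : ℕ) → .{{_ : NonZero d}} →
  Σ (List ℚ) λ p →
    ((n : ℕ) → 0ℚ < evalPoly p (ℕ→ℚ n)) ×
    ((n : ℕ) (x : ℚ) → 0ℚ ≤ x →
      Σ ℕ λ r → (r ℕ.≤ (d ∸ 1) * n) ×
        ((geomSum d x) ^ℚ n ≤ (ℕ→ℚ (Vol d n r) ℚ.* (x ^ℚ r)) ℚ.* evalPoly p (ℕ→ℚ n)))
lemma4 (suc k) =
  linear k ,
  (λ n → subst (0ℚ <_) (sym (evalPoly-linear k n)) (ℕ→ℚ-pos (k * n))) ,
  (λ n x x≥0 → geomSum^≤Vol*^*linear k n x≥0)
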